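{- Let $n\ge1$, let $s$ be an integer with $n/2<s\le n$, and let $\tilde\gamma_s\in\{0,1\}^n$ consist of $n-s$ zeros followed by $s$ ones. Let $\tilde\alpha\in B_+^n$ satisfy $\tilde\alpha\not\le\tilde\gamma_s$ and $\mathcal D(\tilde\alpha)\le\tilde\gamma_s$. Then there is no tuple $\tilde\alpha'\in B_+^n$ with $\tilde\alpha=\mathcal D(\tilde\alpha')$.
   Context: Order on $\{0,1\}^n$ is componentwise. $B_+^n$ is the set of tuples in $\{0,1\}^n$ with more than $n/2$ ones. Indices are cyclic modulo $n$. For $i,j\in\{1,\dots,n\}$ the segment $\tilde\alpha[i:j]$ is $(\alpha_i,\dots,\alpha_j)$ if $i\le j$ and $(\alpha_i,\dots,\alpha_n,\alpha_1,\dots,\alpha_j)$ if $i>j$. Its prefixes are the segments $\tilde\alpha[i:j']$ with $j'$ strictly before $j$ in the cyclic traversal from $i$. A segment is balanced / $0$-dominated if its number of zeros is equal to / greater than its number of ones. A minimal balanced segment is a balanced segment every prefix of which is $0$-dominated. A component $\alpha_i=0$ and a component $\alpha_j=1$ are connected if $\tilde\alpha[i:j]$ is a minimal balanced segment. A component is bound if it is connected to some component, unbound otherwise. For $\tilde\alpha\in B_+^n$, $\mathcal D(\tilde\alpha)$ is obtained from $\tilde\alpha$ by replacing with $0$ the unbound component equal to $1$ having the largest index. -}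

module Defs where

open import Data.Bool using (Bool; true; false)
import Data.Bool as B
open import Data.Nat using (ℕ; zero; suc; _+_; _*_; _∸_; _<_; _≤_; _>_)
open import Data.Nat.DivMod using (_%_; _mod_)
open import Data.Fin using (Fin; toℕ)
open import Data.List using (List; []; _∷_; length; map; upTo; take; filter)
open import Data.Product using (Σ; ∃; _×_; _,_)
open import Data.Sum using (_⊎_)
open import Relation.Binary.PropositionalEquality using (_≡_)
open import Relation.Nullary using (¬_)

-- A tuple in {0,1}^n, positions 0..n-1 (paper's index i+1); true = 1, false = 0.
Tuple : ℕ → Set
Tuple n = Fin n → Bool

onesL : List Bool → ℕ
onesL [] = 0
onesL (true ∷ xs) = suc (onesL xs)
onesL (false ∷ xs) = onesL xs

zerosL : List Bool → ℕ
zerosL [] = 0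
zerosL (true ∷ xs) = zerosL xs
zerosL (false ∷ xs) = suc (zerosL xs)

toList : ∀ {n} → Tuple n → List Bool
toList {zero} α = []
toList {suc m} α = map (λ t → α (t mod suc m)) (upTo (suc m))

B₊ : (n : ℕ) → Tuple n → Set
B₊ n α = n < 2 * onesL (toList α)

_≤ₜ_ : ∀ {n} → Tuple n → Tuple n → Set
α ≤ₜ β = ∀ k → α k B.≤ β k

γ : (n s : ℕ) → Tuple n
γ n s k = (n ∸ s) Data.Nat.≤ᵇ toℕ k

-- cyclic segment α[i:j] (traversal from i to j, both included)
seg : ∀ {n} → Tuple n → Fin n → Fin n → List Bool
seg {zero} α () j
seg {suc m} α i j =
  map (λ t → α ((toℕ i + t) mod suc m))
      (upTo (suc ((toℕ j + suc m ∸ toℕ i) % suc m)))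

Balanced : List Bool → Set
Balanced xs = zerosL xs ≡ onesL xs

ZeroDominated : List Bool → Set
ZeroDominated xs = zerosL xs > onesL xs

MinimalBalanced : List Bool → Set
MinimalBalanced xs =
  Balanced xs × (∀ k → 1 ≤ k → k < length xs → ZeroDominated (take k xs))

Connected : ∀ {n} → Tuple n → Fin n → Fin n → Set
Connected α i j = α i ≡ false × α j ≡ true × MinimalBalanced (seg α i j)

Bound : ∀ {n} → Tuple n → Fin n → Set
Bound α k = ∃ λ l → Connected α k l ⊎ Connected α l k

Unbound : ∀ {n} → Tuple n → Fin n → Set
Unbound α k = ¬ Bound α k

-- IsD α β : β = 𝒟(α), i.e. β is α with its unbound 1 of largest index replaced by 0
IsD : ∀ {n} → Tuple n → Tuple n → Set
IsD {n} α β = Σ (Fin n) λ k →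
    α k ≡ true × Unbound α k
  × (∀ l → toℕ k < toℕ l → α l ≡ true → Bound α l)
  × β k ≡ false
  × (∀ l → ¬ (l ≡ k) → β l ≡ α l)

-- Let β = 𝒟(α) remove the one of α at k, and suppose α = 𝒟(α′) removes the one
-- of α′ at k′.  The proof has two steps.
--  (1) As β ≤ γ_s but α ≰ γ_s, γ_s vanishes at k, hence also before k; so if k
--      were not the first position, the component before it would be a zero of α
--      directly followed by the one at k, i.e. connected to it.  Thus k is first.
--  (2) Walking from the zero α_{k′} around α (which has more ones than zeros), the
--      walk first returns to balance at a one α_q.  It cannot pass the unbound first
--      one of α, so q lies after k′, and α′_q = α_q is bound to a zero α′_w.  If w
--      lies inside the return, the first return would not be minimal; otherwise
--      the segment from w to q passes through the unbound one α′_{k′} and carries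
--      an excess of ones.  Either way we reach a contradiction.

module Submission where

open import Defs
open import Data.Bool using (Bool; true; false; T)
import Data.Bool as Bool
open import Data.Unit using (tt)
open import Data.Nat
open import Data.Nat.Properties
open import Data.Fin using (Fin; toℕ; zero; suc)
open import Data.Fin.Properties using (toℕ-fromℕ<; toℕ-injective; toℕ<n) renaming (_≟_ to _≟ᶠ_)
open import Data.Nat.DivMod
open import Data.List using (List; []; _∷_; _++_; [_]; length; take; applyUpTo)
open import Data.List.Properties using (length-applyUpTo; map-upTo)
open import Data.Product using (Σ; ∃; _×_; _,_; proj₁; proj₂)
open import Data.Sum using (_⊎_; inj₁; inj₂)
open import Data.Empty using (⊥; ⊥-elim)
open import Relation.Binary.PropositionalEquality hiding ([_])
open import Relation.Nullary using (¬_; yes; no)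
open import Relation.Unary using (Decidable)

zerosL-++ : ∀ xs ys → zerosL (xs ++ ys) ≡ zerosL xs + zerosL ys
zerosL-++ [] ys = refl
zerosL-++ (true ∷ xs) ys = zerosL-++ xs ys
zerosL-++ (false ∷ xs) ys = cong suc (zerosL-++ xs ys)

onesL-++ : ∀ xs ys → onesL (xs ++ ys) ≡ onesL xs + onesL ys
onesL-++ [] ys = refl
onesL-++ (true ∷ xs) ys = cong suc (onesL-++ xs ys)
onesL-++ (false ∷ xs) ys = onesL-++ xs ys

zerosL+onesL≡length : ∀ xs → zerosL xs + onesL xs ≡ length xs
zerosL+onesL≡length [] = refl
zerosL+onesL≡length (true ∷ xs) =
  trans (+-suc (zerosL xs) (onesL xs)) (cong suc (zerosL+onesL≡length xs))
zerosL+onesL≡length (false ∷ xs) = cong suc (zerosL+onesL≡length xs)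

onesL-rotate : ∀ b xs → onesL (b ∷ xs) ≡ onesL (xs ++ [ b ])
onesL-rotate true xs = trans (sym (+-comm (onesL xs) 1)) (sym (onesL-++ xs [ true ]))
onesL-rotate false xs = trans (sym (+-identityʳ _)) (sym (onesL-++ xs [ false ]))

balanced-cancelʳ : ∀ xs ys → Balanced (xs ++ ys) → Balanced ys → Balanced xs
balanced-cancelʳ xs ys bal balys = +-cancelʳ-≡ (zerosL ys) (zerosL xs) (onesL xs) (begin
  zerosL xs + zerosL ys ≡⟨ sym (zerosL-++ xs ys) ⟩
  zerosL (xs ++ ys)     ≡⟨ bal ⟩
  onesL (xs ++ ys)      ≡⟨ onesL-++ xs ys ⟩
  onesL xs + onesL ys   ≡⟨ cong (onesL xs +_) (sym balys) ⟩
  onesL xs + zerosL ys  ∎)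
  where open ≡-Reasoning

zeroDominated-prefix : ∀ xs ys → Balanced (xs ++ ys) → zerosL ys < onesL ys → ZeroDominated xs
zeroDominated-prefix xs ys bal ys<  = +-cancelʳ-< (zerosL ys) (onesL xs) (zerosL xs) (begin-strict
  onesL xs + zerosL ys  <⟨ +-monoʳ-< (onesL xs) ys< ⟩
  onesL xs + onesL ys   ≡⟨ sym (onesL-++ xs ys) ⟩
  onesL (xs ++ ys)      ≡⟨ sym bal ⟩
  zerosL (xs ++ ys)     ≡⟨ zerosL-++ xs ys ⟩
  zerosL xs + zerosL ys ∎)
  where open ≤-Reasoning

oneDominated-++-unbalanced : ∀ xs ys → zerosL xs < onesL xs → zerosL ys ≤ onesL ys →
  ¬ Balanced (xs ++ ys)
oneDominated-++-unbalanced xs ys xs< ys≤ bal = <-irrefl refl (begin-strict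
  zerosL (xs ++ ys)     ≡⟨ zerosL-++ xs ys ⟩
  zerosL xs + zerosL ys <⟨ +-mono-<-≤ xs< ys≤ ⟩
  onesL xs + onesL ys   ≡⟨ sym (onesL-++ xs ys) ⟩
  onesL (xs ++ ys)      ≡⟨ sym bal ⟩
  zerosL (xs ++ ys)     ∎)
  where open ≤-Reasoning

-- Appending a digit changes the balance by one: a 0-dominated list that stops
-- being 0-dominated when b is appended was extended by a one and became balanced.
crossing-∷ʳ : ∀ xs b → onesL xs < zerosL xs → zerosL (xs ++ [ b ]) ≤ onesL (xs ++ [ b ]) →
  b ≡ true × Balanced (xs ++ [ b ])
crossing-∷ʳ xs true o<z z≤o = refl , (begin
  zerosL (xs ++ [ true ]) ≡⟨ trans (zerosL-++ xs [ true ]) (+-identityʳ _) ⟩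
  zerosL xs               ≡⟨ ≤-antisym z≤o′ o<z ⟩
  suc (onesL xs)          ≡⟨ onesL-rotate true xs ⟩
  onesL (xs ++ [ true ])  ∎)
  where
  open ≡-Reasoning
  z≤o′ : zerosL xs ≤ suc (onesL xs)
  z≤o′ = subst₂ _≤_ (trans (zerosL-++ xs [ true ]) (+-identityʳ _)) (sym (onesL-rotate true xs)) z≤o
crossing-∷ʳ xs false o<z z≤o = ⊥-elim (<⇒≱ o<z (≤-trans (m≤m+n _ 1)
  (subst₂ _≤_ (zerosL-++ xs [ false ]) (sym (onesL-rotate false xs)) z≤o)))

crossing-∷ : ∀ b ys → zerosL ys < onesL ys → onesL (b ∷ ys) ≤ zerosL (b ∷ ys) →
  b ≡ false × Balanced (b ∷ ys)
crossing-∷ true ys z<o o≤z = ⊥-elim (<⇒≱ z<o (≤-trans (n≤1+n _) o≤z))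
crossing-∷ false ys z<o o≤z = refl , ≤-antisym z<o o≤z

m<n∸o⇒o+m<n : ∀ {m n o} → m < n ∸ o → o + m < n
m<n∸o⇒o+m<n {m} {n} {o} m< = subst (o + m <_) (m+[n∸m]≡n (<⇒≤ o<n)) (+-monoʳ-< o m<)
  where
  o<n : o < n
  o<n = m∸n≢0⇒n<m (λ eq → n≮0 (subst (m <_) eq m<))

applyUpTo-+ : ∀ {A : Set} (f : ℕ → A) L₁ L₂ →
  applyUpTo f (L₁ + L₂) ≡ applyUpTo f L₁ ++ applyUpTo (λ u → f (L₁ + u)) L₂
applyUpTo-+ f zero L₂ = refl
applyUpTo-+ f (suc L₁) L₂ = cong (f 0 ∷_) (applyUpTo-+ (λ u → f (suc u)) L₁ L₂)

applyUpTo-cong : ∀ {A : Set} {f g : ℕ → A} L → (∀ u → u < L → f u ≡ g u) →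
  applyUpTo f L ≡ applyUpTo g L
applyUpTo-cong zero f≗g = refl
applyUpTo-cong (suc L) f≗g =
  cong₂ _∷_ (f≗g 0 z<s) (applyUpTo-cong L (λ u u<L → f≗g (suc u) (s<s u<L)))

take-length-++ : ∀ {A : Set} (xs ys : List A) → take (length xs) (xs ++ ys) ≡ xs
take-length-++ [] ys = refl
take-length-++ (x ∷ xs) ys = cong (x ∷_) (take-length-++ xs ys)

-- The slice h[a, b) = h a, …, h (b ∸ 1) of a sequence h.  A cyclic segment of a
-- tuple will be a slice of its periodic extension, which lets us cut and
-- concatenate segments by plain arithmetic on positions.
slice : ∀ {A : Set} → (ℕ → A) → ℕ → ℕ → List A
slice h a b = applyUpTo (λ u → h (a + u)) (b ∸ a)

module _ {A : Set} (h : ℕ → A) where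

  length-slice : ∀ a b → length (slice h a b) ≡ b ∸ a
  length-slice a b = length-applyUpTo (λ u → h (a + u)) (b ∸ a)

  slice-++ : ∀ {a j b} → a ≤ j → j ≤ b → slice h a b ≡ slice h a j ++ slice h j b
  slice-++ {a} {j} {b} a≤j j≤b = begin
    applyUpTo (λ u → h (a + u)) (b ∸ a)
      ≡⟨ cong (applyUpTo (λ u → h (a + u))) (sym lengths) ⟩
    applyUpTo (λ u → h (a + u)) ((j ∸ a) + (b ∸ j))
      ≡⟨ applyUpTo-+ (λ u → h (a + u)) (j ∸ a) (b ∸ j) ⟩
    slice h a j ++ applyUpTo (λ u → h (a + ((j ∸ a) + u))) (b ∸ j)
      ≡⟨ cong (slice h a j ++_) (applyUpTo-cong (b ∸ j) (λ u _ → cong h (shift u))) ⟩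
    slice h a j ++ slice h j b ∎
    where
    open ≡-Reasoning
    shift : ∀ u → a + ((j ∸ a) + u) ≡ j + u
    shift u = trans (sym (+-assoc a (j ∸ a) u)) (cong (_+ u) (m+[n∸m]≡n a≤j))
    lengths : (j ∸ a) + (b ∸ j) ≡ b ∸ a
    lengths = trans (sym (m+n∸m≡n a _)) (cong (_∸ a) (trans (shift (b ∸ j)) (m+[n∸m]≡n j≤b)))

  slice-single : ∀ a → slice h a (suc a) ≡ [ h a ]
  slice-single a = begin
    applyUpTo (λ u → h (a + u)) (suc a ∸ a) ≡⟨ cong (applyUpTo (λ u → h (a + u))) (m+n∸n≡m 1 a) ⟩
    [ h (a + 0) ]                           ≡⟨ cong [_] (cong h (+-identityʳ a)) ⟩
    [ h a ]                                 ∎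
    where open ≡-Reasoning

  slice-∷ : ∀ {a b} → a < b → slice h a b ≡ h a ∷ slice h (suc a) b
  slice-∷ {a} {b} a<b = trans (slice-++ (n≤1+n a) a<b) (cong (_++ slice h (suc a) b) (slice-single a))

  slice-∷ʳ : ∀ {a b} → a ≤ b → slice h a (suc b) ≡ slice h a b ++ [ h b ]
  slice-∷ʳ {a} {b} a≤b = trans (slice-++ a≤b (n≤1+n b)) (cong (slice h a b ++_) (slice-single b))

  take-slice : ∀ {a j b} → a ≤ j → j ≤ b → take (j ∸ a) (slice h a b) ≡ slice h a j
  take-slice {a} {j} {b} a≤j j≤b = begin
    take (j ∸ a) (slice h a b)                      ≡⟨ cong (take (j ∸ a)) (slice-++ a≤j j≤b) ⟩
    take (j ∸ a) (slice h a j ++ slice h j b)       ≡⟨ cong (λ k → take k (slice h a j ++ slice h j b)) (sym (length-slice a j)) ⟩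
    take (length (slice h a j)) (slice h a j ++ slice h j b) ≡⟨ take-length-++ (slice h a j) (slice h j b) ⟩
    slice h a j                                     ∎
    where open ≡-Reasoning

  slice-cong : ∀ {h′ : ℕ → A} a b → (∀ u → a ≤ u → u < b → h u ≡ h′ u) → slice h a b ≡ slice h′ a b
  slice-cong a b h≗h′ =
    applyUpTo-cong (b ∸ a) (λ u u< → h≗h′ (a + u) (m≤m+n a u) (m<n∸o⇒o+m<n u<))

  slice-periodic : ∀ c → (∀ x → h (c + x) ≡ h x) → ∀ a b → slice h (c + a) (c + b) ≡ slice h a b
  slice-periodic c periodic a b = begin
    applyUpTo (λ u → h (c + a + u)) ((c + b) ∸ (c + a))
      ≡⟨ cong (applyUpTo (λ u → h (c + a + u))) ([m+n]∸[m+o]≡n∸o c b a) ⟩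
    applyUpTo (λ u → h (c + a + u)) (b ∸ a)
      ≡⟨ applyUpTo-cong (b ∸ a) (λ u _ → trans (cong h (+-assoc c a u)) (periodic (a + u))) ⟩
    applyUpTo (λ u → h (a + u)) (b ∸ a) ∎
    where open ≡-Reasoning

minimalBalanced-slice : ∀ (h : ℕ → Bool) {a b} → Balanced (slice h a b) →
  (∀ j → a < j → j < b → ZeroDominated (slice h a j)) → MinimalBalanced (slice h a b)
minimalBalanced-slice h {a} {b} bal prefixes = bal , λ k 1≤k k<len →
  subst ZeroDominated (sym (prefix-is-slice k k<len)) (prefixes (a + k) (a<a+k k 1≤k) (a+k<b k k<len))
  where
  a<a+k : ∀ k → 1 ≤ k → a < a + k
  a<a+k k 1≤k = subst (_≤ a + k) (+-comm a 1) (+-monoʳ-≤ a 1≤k)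
  k<b∸a : ∀ k → k < length (slice h a b) → k < b ∸ a
  k<b∸a k = subst (k <_) (length-slice h a b)
  a+k<b : ∀ k → k < length (slice h a b) → a + k < b
  a+k<b k k< = m<n∸o⇒o+m<n (k<b∸a k k<)
  prefix-is-slice : ∀ k → k < length (slice h a b) → take k (slice h a b) ≡ slice h a (a + k)
  prefix-is-slice k k< = subst (λ i → take i (slice h a b) ≡ slice h a (a + k)) (m+n∸m≡n a k)
    (take-slice h (m≤m+n a k) (<⇒≤ (a+k<b k k<)))

minimalBalanced-properPrefix : ∀ (h : ℕ → Bool) {a b j} → MinimalBalanced (slice h a b) →
  a < j → j < b → ZeroDominated (slice h a j)
minimalBalanced-properPrefix h {a} {b} {j} (_ , prefixes) a<j j<b =
  subst ZeroDominated (take-slice h (<⇒≤ a<j) (<⇒≤ j<b))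
    (prefixes (j ∸ a) (m<n⇒0<n∸m a<j)
      (subst (j ∸ a <_) (sym (length-slice h a b)) (∸-monoˡ-< j<b (<⇒≤ a<j))))

minimalBalanced-prefix : ∀ (h : ℕ → Bool) {a b j} → MinimalBalanced (slice h a b) →
  a < j → j ≤ b → onesL (slice h a j) ≤ zerosL (slice h a j)
minimalBalanced-prefix h minimal a<j j≤b with m≤n⇒m<n∨m≡n j≤b
... | inj₁ j<b = <⇒≤ (minimalBalanced-properPrefix h minimal a<j j<b)
... | inj₂ refl = ≤-reflexive (sym (proj₁ minimal))

module _ {P : ℕ → Set} (P? : Decidable P) where

  least : ∀ a L → P (a + L) → ∃ λ t → a ≤ t × t ≤ a + L × P t × (∀ j → a ≤ j → j < t → ¬ P j)
  least a zero p = a , ≤-refl , m≤m+n a 0 , subst P (+-identityʳ a) p , λ j a≤j j<a _ → <⇒≱ j<a a≤j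
  least a (suc L) p with P? a
  ... | yes pa = a , ≤-refl , m≤m+n a (suc L) , pa , λ j a≤j j<a _ → <⇒≱ j<a a≤j
  ... | no ¬pa with least (suc a) L (subst P (+-suc a L) p)
  ...   | t , a<t , t≤ , pt , below = t , <⇒≤ a<t , subst (t ≤_) (sym (+-suc a L)) t≤ , pt ,
          λ j a≤j j<t → case-split (m≤n⇒m<n∨m≡n a≤j) j<t
    where
    case-split : ∀ {j} → a < j ⊎ a ≡ j → j < t → ¬ P j
    case-split (inj₁ a<j) j<t = below _ a<j j<t
    case-split (inj₂ refl) _ = ¬pa

  greatest : ∀ {a} b → a ≤ b → P a → ∃ λ t → a ≤ t × t ≤ b × P t × (∀ j → t < j → j ≤ b → ¬ P j)
  greatest b a≤b pa with P? b
  ... | yes pb = b , a≤b , ≤-refl , pb , λ j b<j j≤b _ → <⇒≱ b<j j≤b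
  greatest zero z≤n pa | no ¬pb = ⊥-elim (¬pb pa)
  greatest (suc b) a≤b pa | no ¬pb with m≤n⇒m<n∨m≡n a≤b
  ... | inj₂ refl = ⊥-elim (¬pb pa)
  ... | inj₁ a<sb with greatest b (s≤s⁻¹ a<sb) pa
  ...   | t , a≤t , t≤b , pt , above = t , a≤t , m≤n⇒m≤1+n t≤b , pt ,
          λ j t<j j≤sb → case-split t<j (m≤n⇒m<n∨m≡n j≤sb)
    where
    case-split : ∀ {j} → t < j → j < suc b ⊎ j ≡ suc b → ¬ P j
    case-split t<j (inj₁ j<sb) = above _ t<j (s≤s⁻¹ j<sb)
    case-split _ (inj₂ refl) = ¬pb

firstReturn : ∀ (h : ℕ → Bool) a L → h a ≡ false →
  zerosL (slice h a (suc (a + L))) ≤ onesL (slice h a (suc (a + L))) →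
  ∃ λ q → a < q × q ≤ a + L × h q ≡ true × MinimalBalanced (slice h a (suc q))
firstReturn h a L ha≡false no-excess = returnPoint (least {P = NoExcess} noExcess? a L no-excess)
  where
  NoExcess : ℕ → Set
  NoExcess j = zerosL (slice h a (suc j)) ≤ onesL (slice h a (suc j))
  noExcess? : Decidable NoExcess
  noExcess? j = zerosL (slice h a (suc j)) ≤? onesL (slice h a (suc j))
  returnPoint : (∃ λ t → a ≤ t × t ≤ a + L × NoExcess t × (∀ j → a ≤ j → j < t → ¬ NoExcess j)) →
    ∃ λ q → a < q × q ≤ a + L × h q ≡ true × MinimalBalanced (slice h a (suc q))
  returnPoint (t , a≤t , t≤ , noExcess , below) with m≤n⇒m<n∨m≡n a≤t
  ... | inj₂ refl = ⊥-elim (1+n≰n (subst (λ xs → zerosL xs ≤ onesL xs)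
                      (trans (slice-single h a) (cong [_] ha≡false)) noExcess))
  ... | inj₁ (s≤s {n = t′} a≤t′) =
    suc t′ , s≤s a≤t′ , t≤ , returnsWithOne , minimalBalanced-slice h balanced prefixes
    where
    split : slice h a (suc (suc t′)) ≡ slice h a (suc t′) ++ [ h (suc t′) ]
    split = slice-∷ʳ h (m≤n⇒m≤1+n a≤t′)
    crossing : h (suc t′) ≡ true × Balanced (slice h a (suc t′) ++ [ h (suc t′) ])
    crossing = crossing-∷ʳ (slice h a (suc t′)) (h (suc t′)) (≰⇒> (below t′ a≤t′ (n<1+n t′)))
                 (subst (λ xs → zerosL xs ≤ onesL xs) split noExcess)
    returnsWithOne : h (suc t′) ≡ true
    returnsWithOne = proj₁ crossing
    balanced : Balanced (slice h a (suc (suc t′)))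
    balanced = subst Balanced (sym split) (proj₂ crossing)
    prefixes : ∀ j → a < j → j < suc (suc t′) → ZeroDominated (slice h a j)
    prefixes (suc j′) (s≤s a≤j′) j<t = ≰⇒> (below j′ a≤j′ (s≤s⁻¹ j<t))

lastDeparture : ∀ (h : ℕ → Bool) {a e} → a ≤ e → h e ≡ true →
  onesL (slice h a (suc e)) ≤ zerosL (slice h a (suc e)) →
  ∃ λ t → a ≤ t × t < e × h t ≡ false × MinimalBalanced (slice h t (suc e))
lastDeparture h {a} {e} a≤e he≡true no-excess =
  departurePoint (greatest {P = NoExcess} noExcess? e a≤e no-excess)
  where
  NoExcess : ℕ → Set
  NoExcess j = onesL (slice h j (suc e)) ≤ zerosL (slice h j (suc e))
  noExcess? : Decidable NoExcess
  noExcess? j = onesL (slice h j (suc e)) ≤? zerosL (slice h j (suc e))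
  departurePoint : (∃ λ t → a ≤ t × t ≤ e × NoExcess t × (∀ j → t < j → j ≤ e → ¬ NoExcess j)) →
    ∃ λ t → a ≤ t × t < e × h t ≡ false × MinimalBalanced (slice h t (suc e))
  departurePoint (t , a≤t , t≤e , noExcess , above) with m≤n⇒m<n∨m≡n t≤e
  ... | inj₂ refl = ⊥-elim (1+n≰n (subst (λ xs → onesL xs ≤ zerosL xs)
                      (trans (slice-single h e) (cong [_] he≡true)) noExcess))
  ... | inj₁ t<e = t , a≤t , t<e , departsWithZero , minimalBalanced-slice h balanced prefixes
    where
    split : slice h t (suc e) ≡ h t ∷ slice h (suc t) (suc e)
    split = slice-∷ h (m≤n⇒m≤1+n t<e)
    oneDominated : ∀ j → t < j → j ≤ e → zerosL (slice h j (suc e)) < onesL (slice h j (suc e))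
    oneDominated j t<j j≤e = ≰⇒> (above j t<j j≤e)
    crossing : h t ≡ false × Balanced (h t ∷ slice h (suc t) (suc e))
    crossing = crossing-∷ (h t) (slice h (suc t) (suc e)) (oneDominated (suc t) ≤-refl t<e)
                 (subst (λ xs → onesL xs ≤ zerosL xs) split noExcess)
    departsWithZero : h t ≡ false
    departsWithZero = proj₁ crossing
    balanced : Balanced (slice h t (suc e))
    balanced = subst Balanced (sym split) (proj₂ crossing)
    prefixes : ∀ j → t < j → j < suc e → ZeroDominated (slice h t j)
    prefixes j t<j j<se = zeroDominated-prefix (slice h t j) (slice h j (suc e))
      (subst Balanced (slice-++ h (<⇒≤ t<j) (<⇒≤ j<se)) balanced) (oneDominated j t<j (s≤s⁻¹ j<se))

onesL-lap : ∀ (h : ℕ → Bool) c → (∀ x → h (suc c + x) ≡ h x) →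
  ∀ x → onesL (slice h x (x + suc c)) ≡ onesL (slice h 0 (suc c))
onesL-lap h c periodic zero = refl
onesL-lap h c periodic (suc x) = begin
  onesL (slice h (suc x) (suc (x + suc c)))          ≡⟨ cong onesL (slice-∷ʳ h x<x+n) ⟩
  onesL (slice h (suc x) (x + suc c) ++ [ h (x + suc c) ])
    ≡⟨ cong (λ b → onesL (slice h (suc x) (x + suc c) ++ [ b ]))
         (trans (cong h (+-comm x (suc c))) (periodic x)) ⟩
  onesL (slice h (suc x) (x + suc c) ++ [ h x ])     ≡⟨ sym (onesL-rotate (h x) _) ⟩
  onesL (h x ∷ slice h (suc x) (x + suc c))          ≡⟨ cong onesL (sym (slice-∷ h x<x+n)) ⟩
  onesL (slice h x (x + suc c))                      ≡⟨ onesL-lap h c periodic x ⟩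
  onesL (slice h 0 (suc c))                          ∎
  where
  open ≡-Reasoning
  x<x+n : x < x + suc c
  x<x+n = subst (_≤ x + suc c) (+-comm x 1) (+-monoʳ-≤ x (s≤s z≤n))

≤-true : ∀ b → b Bool.≤ true
≤-true true = Bool.b≤b
≤-true false = Bool.f≤t

≤-false : ∀ {b} → b Bool.≤ false → b ≡ false
≤-false Bool.b≤b = refl

γ-zero-before : ∀ {n} s {k l : Fin n} → γ n s k ≡ false → toℕ l ≤ toℕ k → γ n s l ≡ false
γ-zero-before {n} s {k} {l} γk≡false l≤k with (n ∸ s) ≤ᵇ toℕ l in γl
... | false = refl
... | true = ⊥-elim (subst T γk≡false (≤⇒≤ᵇ (≤-trans (≤ᵇ⇒≤ (n ∸ s) (toℕ l) (subst T (sym γl) tt)) l≤k)))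

removed-outside-γ : ∀ {n} s {α β : Tuple n} {k} → (∀ l → ¬ l ≡ k → β l ≡ α l) →
  β ≤ₜ γ n s → ¬ α ≤ₜ γ n s → γ n s k ≡ false
removed-outside-γ {n} s {α} {β} {k} same β≤γ α≰γ with γ n s k in γk
... | false = refl
... | true = ⊥-elim (α≰γ α≤γ)
  where
  α≤γ : α ≤ₜ γ n s
  α≤γ l with l ≟ᶠ k
  ... | yes refl = subst (α k Bool.≤_) (sym γk) (≤-true (α k))
  ... | no l≢k = subst (Bool._≤ γ n s l) (same l l≢k) (β≤γ l)

module Cyclic (m : ℕ) where

  n : ℕ
  n = suc m

  cyc : Tuple n → ℕ → Bool
  cyc α x = α (x mod n)

  toℕ-mod : ∀ x → toℕ (x mod n) ≡ x % n
  toℕ-mod x = toℕ-fromℕ< (m%n<n x n)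

  mod-inverse : ∀ (i : Fin n) → toℕ i mod n ≡ i
  mod-inverse i = toℕ-injective (trans (toℕ-mod (toℕ i)) (m<n⇒m%n≡m (toℕ<n i)))

  mod-periodic : ∀ x → (n + x) mod n ≡ x mod n
  mod-periodic x = toℕ-injective (begin
    toℕ ((n + x) mod n) ≡⟨ toℕ-mod (n + x) ⟩
    (n + x) % n         ≡⟨ cong (_% n) (+-comm n x) ⟩
    (x + n) % n         ≡⟨ [m+n]%n≡m%n x n ⟩
    x % n               ≡⟨ sym (toℕ-mod x) ⟩
    toℕ (x mod n)       ∎)
    where open ≡-Reasoning

  cyc-periodic : ∀ α x → cyc α (n + x) ≡ cyc α x
  cyc-periodic α x = cong α (mod-periodic x)

  %-offset : ∀ x t → (x % n + t) % n ≡ (x + t) % n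
  %-offset x t = begin
    (x % n + t) % n               ≡⟨ %-distribˡ-+ (x % n) t n ⟩
    (x % n % n + t % n) % n       ≡⟨ cong (λ r → (r + t % n) % n) (m%n%n≡m%n x n) ⟩
    (x % n + t % n) % n           ≡⟨ sym (%-distribˡ-+ x t n) ⟩
    (x + t) % n                   ∎
    where open ≡-Reasoning

  distance : ∀ a d → a < n → d < n → ((a + d) % n + n ∸ a) % n ≡ d
  distance a d a<n d<n with a + d <? n
  ... | yes a+d<n = begin
    ((a + d) % n + n ∸ a) % n ≡⟨ cong (λ r → (r + n ∸ a) % n) (m<n⇒m%n≡m a+d<n) ⟩
    (a + d + n ∸ a) % n       ≡⟨ cong (_% n) (trans (cong (_∸ a) (+-assoc a d n)) (m+n∸m≡n a (d + n))) ⟩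
    (d + n) % n               ≡⟨ [m+n]%n≡m%n d n ⟩
    d % n                     ≡⟨ m<n⇒m%n≡m d<n ⟩
    d                         ∎
    where open ≡-Reasoning
  ... | no a+d≮n = begin
    ((a + d) % n + n ∸ a) % n ≡⟨ cong (λ r → (r + n ∸ a) % n) wrapped ⟩
    (a + d ∸ n + n ∸ a) % n   ≡⟨ cong (λ r → (r ∸ a) % n) (m∸n+n≡m n≤a+d) ⟩
    (a + d ∸ a) % n           ≡⟨ cong (_% n) (m+n∸m≡n a d) ⟩
    d % n                     ≡⟨ m<n⇒m%n≡m d<n ⟩
    d                         ∎
    where
    open ≡-Reasoning
    n≤a+d : n ≤ a + d
    n≤a+d = ≮⇒≥ a+d≮n
    wrapped : (a + d) % n ≡ a + d ∸ n
    wrapped = trans (sym (m≤n⇒[n∸m]%m≡n%m n≤a+d))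
      (m<n⇒m%n≡m (subst (a + d ∸ n <_) (m+n∸m≡n n n) (∸-monoˡ-< (+-mono-< a<n d<n) n≤a+d)))

  seg-slice : ∀ α {x y} → x ≤ y → y < x + n → seg α (x mod n) (y mod n) ≡ slice (cyc α) x (suc y)
  seg-slice α {x} {y} x≤y y<x+n = begin
    seg α (x mod n) (y mod n)
      ≡⟨ map-upTo (λ t → α ((toℕ (x mod n) + t) mod n)) (suc (steps (y mod n))) ⟩
    applyUpTo (λ t → α ((toℕ (x mod n) + t) mod n)) (suc (steps (y mod n)))
      ≡⟨ cong (λ L → applyUpTo (λ t → α ((toℕ (x mod n) + t) mod n)) (suc L)) steps≡ ⟩
    applyUpTo (λ t → α ((toℕ (x mod n) + t) mod n)) (suc (y ∸ x))
      ≡⟨ applyUpTo-cong (suc (y ∸ x)) (λ t _ → cong α (toℕ-injective (residue t))) ⟩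
    applyUpTo (λ t → α ((x + t) mod n)) (suc (y ∸ x))
      ≡⟨ cong (applyUpTo (λ t → α ((x + t) mod n))) (sym (+-∸-assoc 1 x≤y)) ⟩
    slice (cyc α) x (suc y) ∎
    where
    open ≡-Reasoning
    steps : Fin n → ℕ
    steps j = (toℕ j + n ∸ toℕ (x mod n)) % n
    d : ℕ
    d = y ∸ x
    y≡x+d : y ≡ x + d
    y≡x+d = sym (m+[n∸m]≡n x≤y)
    d<n : d < n
    d<n = subst (d <_) (m+n∸m≡n x n) (∸-monoˡ-< y<x+n x≤y)
    steps≡ : steps (y mod n) ≡ d
    steps≡ = begin
      (toℕ (y mod n) + n ∸ toℕ (x mod n)) % n ≡⟨ cong₂ (λ r s → (r + n ∸ s) % n) (toℕ-mod y) (toℕ-mod x) ⟩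
      (y % n + n ∸ x % n) % n                 ≡⟨ cong (λ r → (r % n + n ∸ x % n) % n) y≡x+d ⟩
      ((x + d) % n + n ∸ x % n) % n           ≡⟨ cong (λ r → (r + n ∸ x % n) % n) (sym (%-offset x d)) ⟩
      ((x % n + d) % n + n ∸ x % n) % n       ≡⟨ distance (x % n) d (m%n<n x n) d<n ⟩
      d                                       ∎
    residue : ∀ t → toℕ ((toℕ (x mod n) + t) mod n) ≡ toℕ ((x + t) mod n)
    residue t = begin
      toℕ ((toℕ (x mod n) + t) mod n) ≡⟨ toℕ-mod (toℕ (x mod n) + t) ⟩
      (toℕ (x mod n) + t) % n         ≡⟨ cong (λ r → (r + t) % n) (toℕ-mod x) ⟩
      (x % n + t) % n                 ≡⟨ %-offset x t ⟩
      (x + t) % n                     ≡⟨ sym (toℕ-mod (x + t)) ⟩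
      toℕ ((x + t) mod n)             ∎

  lap-position : ∀ (x l : Fin n) → ∃ λ w → toℕ x ≤ w × w < toℕ x + n × l ≡ w mod n
  lap-position x l with toℕ x ≤? toℕ l
  ... | yes x≤l = toℕ l , x≤l , <-≤-trans (toℕ<n l) (m≤n+m n (toℕ x)) , sym (mod-inverse l)
  ... | no x≰l = n + toℕ l , ≤-trans (<⇒≤ (toℕ<n x)) (m≤m+n n (toℕ l)) ,
                 subst (n + toℕ l <_) (+-comm n (toℕ x)) (+-monoʳ-< n (≰⇒> x≰l)) ,
                 sym (trans (mod-periodic (toℕ l)) (mod-inverse l))

  majority : ∀ α → B₊ n α → ∀ x →
    zerosL (slice (cyc α) x (x + n)) < onesL (slice (cyc α) x (x + n))
  majority α more-ones x = +-cancelʳ-< O Z O (begin-strict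
    Z + O              ≡⟨ zerosL+onesL≡length (slice (cyc α) x (x + n)) ⟩
    length (slice (cyc α) x (x + n)) ≡⟨ length-slice (cyc α) x (x + n) ⟩
    x + n ∸ x          ≡⟨ m+n∸m≡n x n ⟩
    n                  <⟨ more-ones ⟩
    2 * onesL (toList α) ≡⟨ cong (2 *_) (sym O≡ones) ⟩
    O + (O + 0)        ≡⟨ cong (O +_) (+-identityʳ O) ⟩
    O + O              ∎)
    where
    open ≤-Reasoning
    Z O : ℕ
    Z = zerosL (slice (cyc α) x (x + n))
    O = onesL (slice (cyc α) x (x + n))
    O≡ones : O ≡ onesL (toList α)
    O≡ones = trans (onesL-lap (cyc α) m (cyc-periodic α) x)
                   (cong onesL (sym (map-upTo (λ t → α (t mod n)) n)))

  -- An unbound one dominates every segment ending at it: otherwise the last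
  -- departure before it would be a zero connected to it.
  unbound-one-dominates : ∀ α {x y} → x ≤ y → y < x + n → α (y mod n) ≡ true →
    Unbound α (y mod n) → zerosL (slice (cyc α) x (suc y)) < onesL (slice (cyc α) x (suc y))
  unbound-one-dominates α {x} {y} x≤y y<x+n one unbound = ≰⇒> λ no-excess →
    let (t , x≤t , t<y , departs , minimal) = lastDeparture (cyc α) x≤y one no-excess
        y<t+n = <-≤-trans y<x+n (+-monoˡ-≤ n x≤t)
    in unbound (t mod n , inj₂ (departs , one , subst MinimalBalanced (sym (seg-slice α (<⇒≤ t<y) y<t+n)) minimal))

  -- A removed one at k > 0 outside γ_s would be preceded by a zero of α (since
  -- β ≤ γ_s vanishes there), and a zero directly followed by a one is connected to it.
  removed-is-first : ∀ s {α β : Tuple n} k → α k ≡ true → Unbound α k →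
    (∀ l → ¬ l ≡ k → β l ≡ α l) → β ≤ₜ γ n s → γ n s k ≡ false → k ≡ zero
  removed-is-first s zero _ _ _ _ _ = refl
  removed-is-first s {α} {β} (suc k₀) one unbound same β≤γ γk≡false =
    ⊥-elim (<-irrefl refl (subst (λ xs → zerosL xs < onesL xs) zero-then-one pair-dominated))
    where
    open ≡-Reasoning
    r : ℕ
    r = toℕ k₀
    k-mod : suc r mod n ≡ suc k₀
    k-mod = mod-inverse (suc k₀)
    r-position : toℕ (r mod n) ≡ r
    r-position = trans (toℕ-mod r) (m<n⇒m%n≡m (<-trans (n<1+n r) (toℕ<n (suc k₀))))
    zero-before : cyc α r ≡ false
    zero-before = trans (sym (same (r mod n) r≢k)) (≤-false (subst (β (r mod n) Bool.≤_) γr (β≤γ (r mod n))))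
      where
      γr : γ n s (r mod n) ≡ false
      γr = γ-zero-before s γk≡false (subst (_≤ suc r) (sym r-position) (n≤1+n r))
      r≢k : ¬ r mod n ≡ suc k₀
      r≢k eq = 1+n≢n (sym (trans (sym r-position) (cong toℕ eq)))
    zero-then-one : slice (cyc α) r (suc (suc r)) ≡ false ∷ true ∷ []
    zero-then-one = begin
      slice (cyc α) r (suc (suc r))            ≡⟨ slice-∷ (cyc α) (m<n⇒m<1+n (n<1+n r)) ⟩
      cyc α r ∷ slice (cyc α) (suc r) (suc (suc r)) ≡⟨ cong (cyc α r ∷_) (slice-single (cyc α) (suc r)) ⟩
      cyc α r ∷ cyc α (suc r) ∷ []             ≡⟨ cong₂ (λ a b → a ∷ b ∷ []) zero-before (trans (cong α k-mod) one) ⟩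
      false ∷ true ∷ []                        ∎
    pair-dominated : zerosL (slice (cyc α) r (suc (suc r))) < onesL (slice (cyc α) r (suc (suc r)))
    pair-dominated = unbound-one-dominates α (n≤1+n r) (<-≤-trans (toℕ<n (suc k₀)) (m≤n+m n r))
      (subst (λ i → α i ≡ true) (sym k-mod) one) (subst (Unbound α) (sym k-mod) unbound)

  lap-injective : ∀ {x v} → x < n → v < n → (x + v) mod n ≡ x mod n → v ≡ 0
  lap-injective {x} {v} x<n v<n same-position = begin
    v                         ≡⟨ sym (distance x v x<n v<n) ⟩
    ((x + v) % n + n ∸ x) % n ≡⟨ cong (λ r → (r + n ∸ x) % n) same-residue ⟩
    (x % n + n ∸ x) % n       ≡⟨ cong (λ r → (r + n ∸ x) % n) (m<n⇒m%n≡m x<n) ⟩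
    (x + n ∸ x) % n           ≡⟨ cong (_% n) (m+n∸m≡n x n) ⟩
    n % n                     ≡⟨ n%n≡0 n ⟩
    0                         ∎
    where
    open ≡-Reasoning
    same-residue : (x + v) % n ≡ x % n
    same-residue = trans (sym (toℕ-mod (x + v))) (trans (cong toℕ same-position) (toℕ-mod x))

  module Removal {α α′ : Tuple n} {k′ : Fin n}
    (first-one : α zero ≡ true) (first-unbound : Unbound α zero) (more-ones : B₊ n α)
    (one′ : α′ k′ ≡ true) (unbound′ : Unbound α′ k′)
    (later-ones-bound : ∀ l → toℕ k′ < toℕ l → α′ l ≡ true → Bound α′ l)
    (zero-at-k′ : α k′ ≡ false) (agree : ∀ l → ¬ l ≡ k′ → α l ≡ α′ l) where

    false≢true : ¬ false ≡ true
    false≢true ()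

    K : ℕ
    K = toℕ k′

    h h′ : ℕ → Bool
    h = cyc α
    h′ = cyc α′

    K-mod : K mod n ≡ k′
    K-mod = mod-inverse k′

    K<n : K < n
    K<n = toℕ<n k′

    0<K : 0 < K
    0<K = n≢0⇒n>0 λ K≡0 → false≢true (trans (sym zero-at-k′)
            (trans (cong α (toℕ-injective {i = k′} {j = zero} K≡0)) first-one))

    agree-inside : ∀ u → K < u → u < K + n → h u ≡ h′ u
    agree-inside u K<u u<K+n = agree (u mod n) not-k′
      where
      d<n : u ∸ K < n
      d<n = subst (u ∸ K <_) (m+n∸m≡n K n) (∸-monoˡ-< u<K+n (<⇒≤ K<u))
      not-k′ : ¬ u mod n ≡ k′
      not-k′ eq = <⇒≢ (m<n⇒0<n∸m K<u) (sym (lap-injective K<n d<n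
        (trans (cong (_mod n) (m+[n∸m]≡n (<⇒≤ K<u))) (trans eq (sym K-mod)))))

    agree-slice : ∀ {a b} → K < a → b ≤ K + n → slice h a b ≡ slice h′ a b
    agree-slice {a} {b} K<a b≤K+n =
      slice-cong h a b (λ u a≤u u<b → agree-inside u (<-≤-trans K<a a≤u) (<-≤-trans u<b b≤K+n))

    -- Since α is in B₊, the walk from the zero α_K returns to balance within one lap.
    first-return : ∃ λ q → K < q × q ≤ K + m × h q ≡ true × MinimalBalanced (slice h K (suc q))
    first-return = firstReturn h K m (trans (cong α K-mod) zero-at-k′)
      (subst (λ e → zerosL (slice h K e) ≤ onesL (slice h K e)) (+-suc K m) (<⇒≤ (majority α more-ones K)))

    -- The return happens before the walk passes position n ≡ 0: otherwise the
    -- part up to the unbound one α₀ would not be 1-dominated.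
    no-wrap : ∀ {q} → MinimalBalanced (slice h K (suc q)) → q < n
    no-wrap {q} minimal with q <? n
    ... | yes q<n = q<n
    ... | no q≮n = ⊥-elim (<⇒≱ dominated (minimalBalanced-prefix h minimal (m<n⇒m<1+n K<n) (s≤s (≮⇒≥ q≮n))))
      where
      n≡0 : n mod n ≡ zero
      n≡0 = toℕ-injective (trans (toℕ-mod n) (n%n≡0 n))
      dominated : zerosL (slice h K (suc n)) < onesL (slice h K (suc n))
      dominated = unbound-one-dominates α (<⇒≤ K<n) (m<n+m n 0<K)
        (subst (λ i → α i ≡ true) (sym n≡0) first-one) (subst (Unbound α) (sym n≡0) first-unbound)

    connected-zero : ∀ {q} → K < q → q < n → h q ≡ true →
      ∃ λ w → K < w × w < K + n × Balanced (seg α′ (w mod n) (q mod n))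
    connected-zero {q} K<q q<n hq =
      from-bound (later-ones-bound (q mod n) (subst (K <_) (sym q-position) K<q) one-at-q)
      where
      q-position : toℕ (q mod n) ≡ q
      q-position = trans (toℕ-mod q) (m<n⇒m%n≡m q<n)
      one-at-q : α′ (q mod n) ≡ true
      one-at-q = trans (sym (agree-inside q K<q (<-≤-trans q<n (m≤n+m n K)))) hq
      from-bound : Bound α′ (q mod n) → ∃ λ w → K < w × w < K + n × Balanced (seg α′ (w mod n) (q mod n))
      from-bound (_ , inj₁ (zero-at-q , _ , _)) = ⊥-elim (false≢true (trans (sym zero-at-q) one-at-q))
      from-bound (l , inj₂ (zero-at-l , _ , minimal)) with lap-position k′ l
      ... | w , K≤w , w<K+n , l≡w = w , K<w , w<K+n , subst (λ i → Balanced (seg α′ i (q mod n))) l≡w (proj₁ minimal)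
        where
        K<w : K < w
        K<w = ≤∧≢⇒< K≤w λ { refl → false≢true (trans (sym zero-at-l) (trans (cong α′ (trans l≡w K-mod)) one′)) }

    -- If the connected zero lies inside the first return h[K, q], the part
    -- h[K, w) would be both balanced and 0-dominated.
    zero-before-return : ∀ {q w} → K < w → w ≤ q → q < n → MinimalBalanced (slice h K (suc q)) →
      ¬ Balanced (seg α′ (w mod n) (q mod n))
    zero-before-return {q} {w} K<w w≤q q<n minimal balanced′ =
      <-irrefl (sym initial-balanced) (minimalBalanced-properPrefix h minimal K<w (s≤s w≤q))
      where
      suc-q≤K+n : suc q ≤ K + n
      suc-q≤K+n = <-≤-trans q<n (m≤n+m n K)
      segment : seg α′ (w mod n) (q mod n) ≡ slice h w (suc q)
      segment = trans (seg-slice α′ w≤q (<-≤-trans q<n (m≤n+m n w))) (sym (agree-slice K<w suc-q≤K+n))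
      initial-balanced : Balanced (slice h K w)
      initial-balanced = balanced-cancelʳ (slice h K w) (slice h w (suc q))
        (subst Balanced (slice-++ h (<⇒≤ K<w) (m≤n⇒m≤1+n w≤q)) (proj₁ minimal))
        (subst Balanced segment balanced′)

    -- If the connected zero lies after q, the segment from it to q runs through
    -- the unbound one α′_K: up to it the segment is 1-dominated (unboundedness),
    -- and after it comes the tail of the first return, which has no excess of zeros.
    zero-after-return : ∀ {q w} → K < q → q < w → w < K + n → MinimalBalanced (slice h K (suc q)) →
      ¬ Balanced (seg α′ (w mod n) (q mod n))
    zero-after-return {q} {w} K<q q<w w<K+n minimal balanced′ =
      oneDominated-++-unbalanced (slice h′ w (suc (n + K))) (slice h′ (suc (n + K)) (suc (n + q)))
        through-K tail-no-excess (subst Balanced segment balanced′)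
      where
      K<w : K < w
      K<w = <-trans K<q q<w
      w≤n+K : w ≤ n + K
      w≤n+K = <⇒≤ (subst (w <_) (+-comm K n) w<K+n)
      segment : seg α′ (w mod n) (q mod n) ≡ slice h′ w (suc (n + K)) ++ slice h′ (suc (n + K)) (suc (n + q))
      segment = begin
        seg α′ (w mod n) (q mod n)       ≡⟨ cong (seg α′ (w mod n)) (sym (mod-periodic q)) ⟩
        seg α′ (w mod n) ((n + q) mod n)
          ≡⟨ seg-slice α′ (≤-trans w≤n+K (+-monoʳ-≤ n (<⇒≤ K<q)))
                          (subst (_< w + n) (+-comm q n) (+-monoˡ-< n q<w)) ⟩
        slice h′ w (suc (n + q))
          ≡⟨ slice-++ h′ (m≤n⇒m≤1+n w≤n+K) (s≤s (+-monoʳ-≤ n (<⇒≤ K<q))) ⟩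
        slice h′ w (suc (n + K)) ++ slice h′ (suc (n + K)) (suc (n + q)) ∎
        where open ≡-Reasoning
      n+K-mod : (n + K) mod n ≡ k′
      n+K-mod = trans (mod-periodic K) K-mod
      through-K : zerosL (slice h′ w (suc (n + K))) < onesL (slice h′ w (suc (n + K)))
      through-K = unbound-one-dominates α′ w≤n+K (subst (_< w + n) (+-comm K n) (+-monoˡ-< n K<w))
        (subst (λ i → α′ i ≡ true) (sym n+K-mod) one′) (subst (Unbound α′) (sym n+K-mod) unbound′)
      tail : slice h′ (suc (n + K)) (suc (n + q)) ≡ slice h (suc K) (suc q)
      tail = begin
        slice h′ (suc (n + K)) (suc (n + q)) ≡⟨ cong₂ (slice h′) (sym (+-suc n K)) (sym (+-suc n q)) ⟩
        slice h′ (n + suc K) (n + suc q)     ≡⟨ slice-periodic h′ n (cyc-periodic α′) (suc K) (suc q) ⟩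
        slice h′ (suc K) (suc q)             ≡⟨ sym (agree-slice (n<1+n K) (<-trans q<w w<K+n)) ⟩
        slice h (suc K) (suc q)              ∎
        where open ≡-Reasoning
      -- the first return starts with the zero α_K, so its remainder has one excess one
      starts-with-zero : Balanced (false ∷ slice h (suc K) (suc q))
      starts-with-zero = subst (λ b → Balanced (b ∷ slice h (suc K) (suc q))) (trans (cong α K-mod) zero-at-k′)
        (subst Balanced (slice-∷ h (s≤s (<⇒≤ K<q))) (proj₁ minimal))
      tail-no-excess : zerosL (slice h′ (suc (n + K)) (suc (n + q))) ≤ onesL (slice h′ (suc (n + K)) (suc (n + q)))
      tail-no-excess = subst (λ xs → zerosL xs ≤ onesL xs) (sym tail)
        (≤-trans (n≤1+n _) (≤-reflexive starts-with-zero))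

    impossible : ⊥
    impossible with first-return
    ... | q , K<q , _ , hq , minimal with no-wrap minimal
    ...   | q<n with connected-zero K<q q<n hq
    ...     | w , K<w , w<K+n , balanced′ with w ≤? q
    ...       | yes w≤q = zero-before-return K<w w≤q q<n minimal balanced′
    ...       | no w≰q = zero-after-return K<q (≰⇒> w≰q) w<K+n minimal balanced′

lemma5 : (n s : ℕ) → 1 ≤ n → n < 2 * s → s ≤ n →
    (α : Tuple n) → B₊ n α → ¬ (α ≤ₜ γ n s) →
    Σ (Tuple n) (λ β → IsD α β × β ≤ₜ γ n s) →
    ¬ Σ (Tuple n) (λ α′ → B₊ n α′ × IsD α′ α)
lemma5 zero s () _ _ _ _ _ _ _
lemma5 (suc m) s _ _ _ α more-ones α≰γ (β , (k , one , unbound , _ , _ , same) , β≤γ)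
       (α′ , _ , (k′ , one′ , unbound′ , later-ones-bound , zero-at-k′ , agree)) =
  Removal.impossible (subst (λ i → α i ≡ true) k≡zero one) (subst (Unbound α) k≡zero unbound)
    more-ones one′ unbound′ later-ones-bound zero-at-k′ agree
  where
  open Cyclic m
  k≡zero : k ≡ zero
  k≡zero = removed-is-first s k one unbound same β≤γ (removed-outside-γ s same β≤γ α≰γ)
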